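{- Let $t$ be a closed $\bar\beta_v$-normalizable term. Then for any type derivation $\pi$ with conclusion $\vdash t\colon\mathbf{0}$, $\mathrm{leng}_{\beta_v}(t)=|\pi|$.
   Context: Terms: $t ::= x \mid \lambda x.t \mid tu$ up to $\alpha$-conversion; closed means no free variables; values are variables and abstractions. Balanced contexts: $B ::= [\cdot] \mid (\lambda x.B)t \mid Bt \mid tB$. Root rules: $(\lambda x.t)v \mapsto_{\beta_v} t\{v/x\}$ ($v$ value); $(\lambda x.t)us \mapsto_{\sigma_1} (\lambda x.ts)u$ if $x\notin\mathrm{fv}(s)$; $v((\lambda x.s)u) \mapsto_{\sigma_3} (\lambda x.vs)u$ if $v$ value and $x\notin\mathrm{fv}(v)$. $\to_{\bar\beta_v}$ is the closure of $\mapsto_{\beta_v}$ under balanced contexts, $\to_{\bar\sigma}$ the closure of $\mapsto_{\sigma_1}\cup\mapsto_{\sigma_3}$ under balanced contexts, and $\to_{\bar{\mathsf{sh}}}=\to_{\bar\beta_v}\cup\to_{\bar\sigma}$. $\mathrm{leng}_{\beta_v}(t)$ is the number of $\bar\beta_v$-steps in any $\to_{\bar{\mathsf{sh}}}$-reduction sequence from $t$ to its $\bar{\mathsf{sh}}$-normal form (independent of the sequence), and $\infty$ if there is none. Types: negative $N ::= P\multimap Q$; positive $P,Q ::= [N_1,\dots,N_n]$ finite multisets ($n\ge0$), $\mathbf{0}$ the empty multiset. Environments: maps from variables to positive types, $\mathbf{0}$ almost everywhere; $\uplus$ pointwise multiset sum; $\vdash t\colon P$ means the environment is everywhere $\mathbf{0}$.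 Rules: (ax) $x\colon P\vdash x\colon P$; (@) from $\Gamma\vdash t\colon[P\multimap Q]$ and $\Gamma'\vdash u\colon P$ infer $\Gamma\uplus\Gamma'\vdash tu\colon Q$; ($\lambda$) for $n\ge0$, from $\Gamma_i,x\colon P_i\vdash t\colon Q_i$ ($1\le i\le n$) infer $\biguplus_i\Gamma_i\vdash\lambda x.t\colon[P_1\multimap Q_1,\dots,P_n\multimap Q_n]$. $|\pi|$ is the number of (@) rules in $\pi$. -}

module Defs where

open import Data.Nat using (ℕ; zero; suc; _+_)
open import Data.Fin using (Fin; zero; suc)
open import Data.List using (List; []; _∷_; _++_)
open import Data.Vec using (Vec; replicate; zipWith; _[_]≔_)
import Data.Vec as Vec
open import Data.Vec.Relation.Binary.Pointwise.Inductive using (Pointwise)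
open import Data.Product using (Σ; _×_; _,_)
open import Relation.Nullary using (¬_)
open import Relation.Binary.Construct.Closure.ReflexiveTransitive using (Star)

-- Terms: scoped de Bruijn syntax (α-conversion is built in).
-- Tm n = terms whose free variables are among n variables;
-- closed terms are Tm 0.

data Tm (n : ℕ) : Set where
  var : Fin n → Tm n
  lam : Tm (suc n) → Tm n
  app : Tm n → Tm n → Tm n

data Value {n : ℕ} : Tm n → Set where
  v-var : (x : Fin n) → Value (var x)
  v-lam : (t : Tm (suc n)) → Value (lam t)

ext : {n m : ℕ} → (Fin n → Fin m) → Fin (suc n) → Fin (suc m)
ext ρ zero    = zero
ext ρ (suc x) = suc (ρ x)

rename : {n m : ℕ} → (Fin n → Fin m) → Tm n → Tm m
rename ρ (var x)   = var (ρ x)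
rename ρ (lam t)   = lam (rename (ext ρ) t)
rename ρ (app t u) = app (rename ρ t) (rename ρ u)

wk : {n : ℕ} → Tm n → Tm (suc n)
wk = rename suc

exts : {n m : ℕ} → (Fin n → Tm m) → Fin (suc n) → Tm (suc m)
exts σ zero    = var zero
exts σ (suc x) = wk (σ x)

subst : {n m : ℕ} → (Fin n → Tm m) → Tm n → Tm m
subst σ (var x)   = σ x
subst σ (lam t)   = lam (subst (exts σ) t)
subst σ (app t u) = app (subst σ t) (subst σ u)

-- t {v / x} where x is the variable bound by the enclosing λ (index 0)
single : {n : ℕ} → Tm n → Fin (suc n) → Tm n
single v zero    = v
single v (suc x) = var x

_[_/0] : {n : ℕ} → Tm (suc n) → Tm n → Tm n
t [ v /0] = subst (single v) t

data _↦βv_ {n : ℕ} : Tm n → Tm n → Set where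
  βv : (t : Tm (suc n)) (v : Tm n) → Value v →
       app (lam t) v ↦βv (t [ v /0])

data _↦σ_ {n : ℕ} : Tm n → Tm n → Set where
  -- (λx.t)u s ↦ (λx.ts)u  (x ∉ fv(s) is expressed by weakening s)
  σ₁ : (t : Tm (suc n)) (u s : Tm n) →
       app (app (lam t) u) s ↦σ app (lam (app t (wk s))) u
  -- v((λx.s)u) ↦ (λx.vs)u  (v value, x ∉ fv(v) by weakening v)
  σ₃ : (v : Tm n) (s : Tm (suc n)) (u : Tm n) → Value v →
       app v (app (lam s) u) ↦σ app (lam (app (wk v) s)) u

-- Closure under balanced contexts B ::= [·] | (λx.B)t | Bt | tB

Rel : Set₁
Rel = {n : ℕ} → Tm n → Tm n → Set

data Bal (R : Rel) {n : ℕ} : Tm n → Tm n → Set where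
  root   : {t t' : Tm n} → R t t' → Bal R t t'
  redexλ : {s s' : Tm (suc n)} {u : Tm n} →
           Bal R s s' → Bal R (app (lam s) u) (app (lam s') u)
  appL   : {t t' u : Tm n} → Bal R t t' → Bal R (app t u) (app t' u)
  appR   : {t u u' : Tm n} → Bal R u u' → Bal R (app t u) (app t u')

_→βv_ : Rel
_→βv_ = Bal _↦βv_

_→σ_ : Rel
_→σ_ = Bal _↦σ_

data _→sh_ {n : ℕ} (t t' : Tm n) : Set where
  shβ : t →βv t' → t →sh t'
  shσ : t →σ t' → t →sh t'

ShNormal : {n : ℕ} → Tm n → Set
ShNormal {n} t = (t' : Tm n) → ¬ (t →sh t')

βvNormal : {n : ℕ} → Tm n → Set
βvNormal {n} t = (t' : Tm n) → ¬ (t →βv t')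

βvNormalizable : {n : ℕ} → Tm n → Set
βvNormalizable {n} t = Σ (Tm n) λ u → Star _→βv_ t u × βvNormal u

data ShSeq {n : ℕ} : Tm n → Tm n → Set where
  done  : {t : Tm n} → ShSeq t t
  stepβ : {t t' u : Tm n} → t →βv t' → ShSeq t' u → ShSeq t u
  stepσ : {t t' u : Tm n} → t →σ t' → ShSeq t' u → ShSeq t u

#βv : {n : ℕ} {t u : Tm n} → ShSeq t u → ℕ
#βv done          = 0
#βv (stepβ _ ρ)   = suc (#βv ρ)
#βv (stepσ _ ρ)   = #βv ρ

-- Types: finite multisets represented by lists, taken up to the
-- (hereditary) multiset equivalence ≈P below.

data Neg : Set where
  _⊸_ : List Neg → List Neg → Neg

Pos : Set
Pos = List Neg

𝟎 : Pos
𝟎 = []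

mutual
  data _≈N_ : Neg → Neg → Set where
    ⊸≈ : {P P' Q Q' : Pos} → P ≈P P' → Q ≈P Q' → (P ⊸ Q) ≈N (P' ⊸ Q')

  -- permutation up to ≈N
  data _≈P_ : Pos → Pos → Set where
    []≈ : [] ≈P []
    ∷≈  : {N N' : Neg} {Ps xs ys : Pos} →
          N ≈N N' → Ps ≈P (xs ++ ys) → (N ∷ Ps) ≈P (xs ++ (N' ∷ ys))

-- Environments over the n variables in scope (all other variables are 𝟎)
Env : ℕ → Set
Env n = Vec Pos n

emptyEnv : (n : ℕ) → Env n
emptyEnv n = replicate n 𝟎

_⊎E_ : {n : ℕ} → Env n → Env n → Env n
_⊎E_ = zipWith _++_

_≈E_ : {n : ℕ} → Env n → Env n → Set
_≈E_ = Pointwise _≈P_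

-- Typing derivations.  The rule `conv` only moves between list
-- representatives of the same multisets; it is not counted in |π|.
mutual
  data _⊢_∶_ {n : ℕ} : Env n → Tm n → Pos → Set where
    ax   : (x : Fin n) (P : Pos) → (emptyEnv n [ x ]≔ P) ⊢ var x ∶ P
    at   : {Γ Γ' : Env n} {t u : Tm n} {P Q : Pos} →
           Γ ⊢ t ∶ ((P ⊸ Q) ∷ []) → Γ' ⊢ u ∶ P → (Γ ⊎E Γ') ⊢ app t u ∶ Q
    abs  : {Γ : Env n} {t : Tm (suc n)} {P : Pos} →
           Premises Γ t P → Γ ⊢ lam t ∶ P
    conv : {Γ Γ' : Env n} {t : Tm n} {P P' : Pos} →
           Γ ⊢ t ∶ P → Γ ≈E Γ' → P ≈P P' → Γ' ⊢ t ∶ P'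

  -- the n ≥ 0 premises Γᵢ, x:Pᵢ ⊢ t : Qᵢ of rule (λ), concluding
  -- ⊎ᵢ Γᵢ ⊢ λx.t : [P₁ ⊸ Q₁, …, Pₙ ⊸ Qₙ]
  data Premises {n : ℕ} : Env n → Tm (suc n) → Pos → Set where
    none : {t : Tm (suc n)} → Premises (emptyEnv n) t []
    more : {Γ Γ' : Env n} {t : Tm (suc n)} {P Q R : Pos} →
           (P Vec.∷ Γ) ⊢ t ∶ Q → Premises Γ' t R →
           Premises (Γ ⊎E Γ') t ((P ⊸ Q) ∷ R)

mutual
  size : {n : ℕ} {Γ : Env n} {t : Tm n} {P : Pos} → Γ ⊢ t ∶ P → ℕ
  size (ax _ _)     = 0
  size (at π π')    = suc (size π + size π')
  size (abs ps)     = sizes ps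
  size (conv π _ _) = size π

  sizes : {n : ℕ} {Γ : Env n} {t : Tm (suc n)} {P : Pos} → Premises Γ t P → ℕ
  sizes none        = 0
  sizes (more π ps) = size π + sizes ps

module Submission where

open import Defs
open import Level using (0ℓ)
open import Algebra.Bundles using (CommutativeMonoid)
import Algebra.Properties.CommutativeSemigroup as CommutativeSemigroupProperties
open import Data.Nat using (ℕ; zero; suc; _+_; _*_)
open import Data.Nat.Properties using (+-assoc; +-suc; +-identityʳ; *-identityʳ; *-zeroʳ; *-suc; suc-injective; +-commutativeSemigroup)
open import Data.Fin using (Fin; zero; suc; punchIn; punchOut; _≟_)
open import Data.Fin.Properties using (punchInᵢ≢i; punchIn-punchOut)
open import Data.List using (List; []; _∷_; _++_; length)
open import Data.List.Properties using (++-assoc; ++-identityʳ; length-++; ∷-injective; ++-conicalˡ; ++-conicalʳ)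
open import Data.Vec using (Vec; []; _∷_; lookup; replicate; zipWith; _[_]≔_; insertAt; removeAt)
open import Data.Vec.Properties using (lookup-zipWith; lookup-replicate; lookup∘update; lookup∘update′; []≔-lookup; zipWith-replicate)
open import Data.Vec.Relation.Binary.Pointwise.Inductive using (Pointwise; []; _∷_)
import Data.Vec.Relation.Binary.Pointwise.Inductive as Pointwise
open import Data.Product using (Σ; ∃; ∃₂; _×_; _,_; proj₁; proj₂)
open import Data.Sum using (_⊎_; inj₁; inj₂)
open import Relation.Nullary using (yes; no)
open import Data.Empty using (⊥-elim)
open import Function using (_∘_)
open import Relation.Binary.PropositionalEquality using (_≡_; refl; sym; trans; cong; cong₂; module ≡-Reasoning) renaming (subst to ≡-subst)

-- Quantitative subject reduction: a βv-step in a balanced context turns a derivation π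
-- into one with exactly one (@) rule less, while a σ-step keeps |π|. The βv case rests on
-- an additive substitution lemma: a derivation of a value at a multiset type Q₁ ++ Q₂
-- splits into derivations at Q₁ and at Q₂ whose sizes add up, so the derivation of the
-- substituted value can be shared out among the occurrences of the variable. A closed
-- sh-normal term is an abstraction, and an abstraction of type 𝟎 is derived by rule (λ)
-- without premises, hence without (@) rules: every sh-reduction sequence to normal form
-- therefore has exactly |π| βv-steps. Such a sequence exists because a closed term that is
-- not an abstraction has a βv-redex, and each βv-step decreases |π|.

private
  variable
    A : Set
    n : ℕ

-- Multiset equivalence

++-∷-split : (xs : List A) (y : A) (ys as bs : List A) → xs ++ y ∷ ys ≡ as ++ bs →
  (∃ λ zs → as ≡ xs ++ y ∷ zs × ys ≡ zs ++ bs) ⊎ (∃ λ ws → bs ≡ ws ++ y ∷ ys × xs ≡ as ++ ws)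
++-∷-split xs       y ys []       bs eq   = inj₂ (xs , sym eq , refl)
++-∷-split []       y ys (a ∷ as) bs refl = inj₁ (as , refl , refl)
++-∷-split (x ∷ xs) y ys (a ∷ as) bs eq with ∷-injective eq
... | refl , eq′ with ++-∷-split xs y ys as bs eq′
... | inj₁ (zs , refl , eq) = inj₁ (zs , refl , eq)
... | inj₂ (ws , eq , refl) = inj₂ (ws , eq , refl)

mutual
  ≈N-refl : {N : Neg} → N ≈N N
  ≈N-refl {P ⊸ Q} = ⊸≈ ≈P-refl ≈P-refl

  ≈P-refl : {P : Pos} → P ≈P P
  ≈P-refl {[]}    = []≈
  ≈P-refl {N ∷ P} = ∷≈ {xs = []} ≈N-refl ≈P-refl

≈P-reflexive : {P Q : Pos} → P ≡ Q → P ≈P Q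
≈P-reflexive refl = ≈P-refl

≈P-length : {P Q : Pos} → P ≈P Q → length P ≡ length Q
≈P-length []≈ = refl
≈P-length (∷≈ {Ps = Ps} {xs} {ys} _ p) = begin
  suc (length Ps)               ≡⟨ cong suc (≈P-length p) ⟩
  suc (length (xs ++ ys))       ≡⟨ cong suc (length-++ xs) ⟩
  suc (length xs + length ys)   ≡⟨ +-suc (length xs) (length ys) ⟨
  length xs + suc (length ys)   ≡⟨ length-++ xs ⟨
  length (xs ++ _ ∷ ys)         ∎
  where open ≡-Reasoning

≈P-𝟎⁻ : {P : Pos} → P ≈P 𝟎 → P ≡ 𝟎
≈P-𝟎⁻ {[]}    _ = refl
≈P-𝟎⁻ {_ ∷ _} p with ≈P-length p
... | ()

≈P-insert : {N N′ : Neg} (xs ys : Pos) {R : Pos} → N ≈N N′ → (xs ++ ys) ≈P R → (xs ++ N ∷ ys) ≈P (N′ ∷ R)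
≈P-insert []       ys e r                       = ∷≈ {xs = []} e r
≈P-insert (x ∷ xs) ys e (∷≈ {xs = cs} {ds} e′ r) = ∷≈ {xs = _ ∷ cs} {ds} e′ (≈P-insert xs ys e r)

mutual
  ≈N-sym : {N N′ : Neg} → N ≈N N′ → N′ ≈N N
  ≈N-sym (⊸≈ p q) = ⊸≈ (≈P-sym p) (≈P-sym q)

  ≈P-sym : {P Q : Pos} → P ≈P Q → Q ≈P P
  ≈P-sym []≈                     = []≈
  ≈P-sym (∷≈ {xs = xs} {ys} e p) = ≈P-insert xs ys (≈N-sym e) (≈P-sym p)

record Extraction (N : Neg) (rest R : Pos) : Set where
  constructor extraction
  field
    {before after} : Pos
    {N′}           : Neg
    R≡    : R ≡ before ++ N′ ∷ after
    N≈N′  : N ≈N N′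
    rest≈ : rest ≈P (before ++ after)

≈P-extract : {N : Neg} (xs ys : Pos) {R : Pos} → (xs ++ N ∷ ys) ≈P R → Extraction N (xs ++ ys) R
≈P-extract []       ys (∷≈ e p) = extraction refl e p
≈P-extract (_ ∷ xs) ys (∷≈ {N' = x′} {xs = cs} {ds} e p) with ≈P-extract xs ys p
... | extraction {as} {bs} {M} R≡ N≈M rest≈ with ++-∷-split as M bs cs ds (sym R≡)
...   | inj₁ (zs , refl , refl) =
  extraction (++-assoc as (M ∷ zs) (x′ ∷ ds)) N≈M
    (≡-subst (_ ≈P_) (++-assoc as zs (x′ ∷ ds))
      (∷≈ {xs = as ++ zs} e (≡-subst (_ ≈P_) (sym (++-assoc as zs ds)) rest≈)))
...   | inj₂ (ws , refl , refl) =
  extraction (sym (++-assoc cs (x′ ∷ ws) (M ∷ bs))) N≈M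
    (≡-subst (_ ≈P_) (sym (++-assoc cs (x′ ∷ ws) bs))
      (∷≈ {xs = cs} e (≡-subst (_ ≈P_) (++-assoc cs ws bs) rest≈)))

mutual
  ≈N-trans : {N N′ N′′ : Neg} → N ≈N N′ → N′ ≈N N′′ → N ≈N N′′
  ≈N-trans (⊸≈ p q) (⊸≈ p′ q′) = ⊸≈ (≈P-trans p p′) (≈P-trans q q′)

  ≈P-trans : {P Q R : Pos} → P ≈P Q → Q ≈P R → P ≈P R
  ≈P-trans []≈                     q = q
  ≈P-trans (∷≈ {xs = xs} {ys} e p) q with ≈P-extract xs ys q
  ... | extraction refl e′ p′ = ∷≈ (≈N-trans e e′) (≈P-trans p p′)

≈P-++⁺ : {P P′ Q Q′ : Pos} → P ≈P P′ → Q ≈P Q′ → (P ++ Q) ≈P (P′ ++ Q′)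
≈P-++⁺             []≈                                q = q
≈P-++⁺ {Q′ = Q′} (∷≈ {N' = N′} {xs = xs} {ys} e p) q =
  ≡-subst (_ ≈P_) (sym (++-assoc xs (N′ ∷ ys) Q′))
    (∷≈ {xs = xs} e (≡-subst (_ ≈P_) (++-assoc xs ys Q′) (≈P-++⁺ p q)))

≈P-++-comm : (P Q : Pos) → (P ++ Q) ≈P (Q ++ P)
≈P-++-comm []      Q = ≈P-reflexive (sym (++-identityʳ Q))
≈P-++-comm (N ∷ P) Q = ∷≈ {xs = Q} ≈N-refl (≈P-++-comm P Q)

≈P-singleton⁻ : {M N : Neg} {R : Pos} → (M ∷ R) ≈P (N ∷ []) → M ≈N N × R ≡ 𝟎
≈P-singleton⁻ p with ≈P-extract [] _ p
... | extraction {[]} {[]} refl M≈N R≈𝟎 = M≈N , ≈P-𝟎⁻ R≈𝟎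
... | extraction {[]} {_ ∷ _} () _ _
... | extraction {_ ∷ []} () _ _
... | extraction {_ ∷ _ ∷ _} () _ _

Pos-commutativeMonoid : CommutativeMonoid 0ℓ 0ℓ
Pos-commutativeMonoid = record
  { Carrier             = Pos
  ; _≈_                 = _≈P_
  ; _∙_                 = _++_
  ; ε                   = 𝟎
  ; isCommutativeMonoid = record
    { isMonoid = record
      { isSemigroup = record
        { isMagma = record
          { isEquivalence = record { refl = ≈P-refl ; sym = ≈P-sym ; trans = ≈P-trans }
          ; ∙-cong        = ≈P-++⁺
          }
        ; assoc = λ P Q R → ≈P-reflexive (++-assoc P Q R)
        }
      ; identity = (λ _ → ≈P-refl) , (λ P → ≈P-reflexive (++-identityʳ P))
      }
    ; comm = ≈P-++-comm
    }
  }

module Pos = CommutativeMonoid Pos-commutativeMonoid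

-- Vectors and environments

insertAt-replicate : (i : Fin (suc n)) (x : A) → insertAt (replicate n x) i x ≡ replicate (suc n) x
insertAt-replicate            zero    x = refl
insertAt-replicate {n = suc n} (suc i) x = cong (x ∷_) (insertAt-replicate i x)

removeAt-replicate : (i : Fin (suc n)) (x : A) → removeAt (replicate (suc n) x) i ≡ replicate n x
removeAt-replicate            zero    x = refl
removeAt-replicate {n = suc n} (suc i) x = cong (x ∷_) (removeAt-replicate i x)

removeAt-suc : (x : A) (xs : Vec A (suc n)) (i : Fin (suc n)) → removeAt (x ∷ xs) (suc i) ≡ x ∷ removeAt xs i
removeAt-suc x (_ ∷ _) i = refl

zipWith-insertAt : (f : A → A → A) (xs ys : Vec A n) (i : Fin (suc n)) (x y : A) →
  insertAt (zipWith f xs ys) i (f x y) ≡ zipWith f (insertAt xs i x) (insertAt ys i y)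
zipWith-insertAt f xs       ys       zero    x y = refl
zipWith-insertAt f (x′ ∷ xs) (y′ ∷ ys) (suc i) x y = cong (f x′ y′ ∷_) (zipWith-insertAt f xs ys i x y)

zipWith-removeAt : (f : A → A → A) (xs ys : Vec A (suc n)) (i : Fin (suc n)) →
  removeAt (zipWith f xs ys) i ≡ zipWith f (removeAt xs i) (removeAt ys i)
zipWith-removeAt f (x ∷ xs)          (y ∷ ys)          zero    = refl
zipWith-removeAt f (x ∷ xs@(_ ∷ _)) (y ∷ ys@(_ ∷ _)) (suc i) = cong (f x y ∷_) (zipWith-removeAt f xs ys i)

zipWith-[]≔ : (f : A → A → A) (xs ys : Vec A n) (i : Fin n) (x y : A) →
  zipWith f (xs [ i ]≔ x) (ys [ i ]≔ y) ≡ zipWith f xs ys [ i ]≔ f x y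
zipWith-[]≔ f (_ ∷ _)   (_ ∷ _)   zero    x y = refl
zipWith-[]≔ f (x′ ∷ xs) (y′ ∷ ys) (suc i) x y = cong (f x′ y′ ∷_) (zipWith-[]≔ f xs ys i x y)

replicate-[]≔ : (i : Fin n) (x : A) → replicate n x [ i ]≔ x ≡ replicate n x
replicate-[]≔ {n} i x =
  trans (cong (replicate n x [ i ]≔_) (sym (lookup-replicate i x))) ([]≔-lookup (replicate n x) i)

insertAt-[]≔ : (xs : Vec A n) (i : Fin (suc n)) (j : Fin n) (x y : A) →
  insertAt (xs [ j ]≔ y) i x ≡ insertAt xs i x [ punchIn i j ]≔ y
insertAt-[]≔ (_ ∷ _)  zero    j       x y = refl
insertAt-[]≔ (_ ∷ _)  (suc i) zero    x y = refl
insertAt-[]≔ (x′ ∷ xs) (suc i) (suc j) x y = cong (x′ ∷_) (insertAt-[]≔ xs i j x y)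

removeAt-[]≔ : (xs : Vec A (suc n)) (i : Fin (suc n)) (y : A) → removeAt (xs [ i ]≔ y) i ≡ removeAt xs i
removeAt-[]≔ (_ ∷ _)          zero    y = refl
removeAt-[]≔ (x ∷ xs@(_ ∷ _)) (suc i) y =
  trans (removeAt-suc x (xs [ i ]≔ y) i) (cong (x ∷_) (removeAt-[]≔ xs i y))

removeAt-[]≔-punchIn : (xs : Vec A (suc n)) (i : Fin (suc n)) (j : Fin n) (y : A) →
  removeAt (xs [ punchIn i j ]≔ y) i ≡ removeAt xs i [ j ]≔ y
removeAt-[]≔-punchIn (_ ∷ _ ∷ _)      zero    j       y = refl
removeAt-[]≔-punchIn (_ ∷ _ ∷ _)      (suc i) zero    y = refl
removeAt-[]≔-punchIn (x ∷ xs@(_ ∷ _)) (suc i) (suc j) y =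
  trans (removeAt-suc x (xs [ punchIn i j ]≔ y) i) (cong (x ∷_) (removeAt-[]≔-punchIn xs i j y))

module _ {_∼_ : A → A → Set} where

  insertAt⁺ : {xs ys : Vec A n} {x y : A} (i : Fin (suc n)) →
              Pointwise _∼_ xs ys → x ∼ y → Pointwise _∼_ (insertAt xs i x) (insertAt ys i y)
  insertAt⁺ zero    xs∼ys        x∼y = x∼y ∷ xs∼ys
  insertAt⁺ (suc i) (x′∼y′ ∷ xs∼ys) x∼y = x′∼y′ ∷ insertAt⁺ i xs∼ys x∼y

  removeAt⁺ : {xs ys : Vec A (suc n)} (i : Fin (suc n)) →
              Pointwise _∼_ xs ys → Pointwise _∼_ (removeAt xs i) (removeAt ys i)
  removeAt⁺ zero    (_ ∷ xs∼ys)                  = xs∼ys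
  removeAt⁺ (suc i) (x∼y ∷ xs∼ys@(_ ∷ _))        = x∼y ∷ removeAt⁺ i xs∼ys

  []≔⁺ : {xs ys : Vec A n} {x y : A} (i : Fin n) →
         Pointwise _∼_ xs ys → x ∼ y → Pointwise _∼_ (xs [ i ]≔ x) (ys [ i ]≔ y)
  []≔⁺ zero    (_ ∷ xs∼ys)     x∼y = x∼y ∷ xs∼ys
  []≔⁺ (suc i) (x′∼y′ ∷ xs∼ys) x∼y = x′∼y′ ∷ []≔⁺ i xs∼ys x∼y

Env-commutativeMonoid : ℕ → CommutativeMonoid 0ℓ 0ℓ
Env-commutativeMonoid n = record
  { Carrier             = Env n
  ; _≈_                 = _≈E_
  ; _∙_                 = _⊎E_
  ; ε                   = emptyEnv n
  ; isCommutativeMonoid = record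
    { isMonoid = record
      { isSemigroup = record
        { isMagma = record
          { isEquivalence = Pointwise.isEquivalence Pos.isEquivalence n
          ; ∙-cong        = Pointwise.zipWith-cong Pos.∙-cong
          }
        ; assoc = Pointwise.zipWith-assoc Pos.assoc
        }
      ; identity = Pointwise.zipWith-identityˡ Pos.identityˡ , Pointwise.zipWith-identityʳ Pos.identityʳ
      }
    ; comm = Pointwise.zipWith-comm Pos.comm
    }
  }

module Env {n : ℕ} where
  open CommutativeMonoid (Env-commutativeMonoid n) public
  open CommutativeSemigroupProperties commutativeSemigroup public

module ℕ+ = CommutativeSemigroupProperties +-commutativeSemigroup

singleton-env-split : (x : Fin n) {P Q R : Pos} → P ≈P (Q ++ R) →
  (emptyEnv n [ x ]≔ P) ≈E ((emptyEnv n [ x ]≔ Q) ⊎E (emptyEnv n [ x ]≔ R))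
singleton-env-split {n} x {Q = Q} {R} P≈ = Env.trans ([]≔⁺ x Env.refl P≈) (Env.reflexive (begin
  emptyEnv n [ x ]≔ (Q ++ R)                               ≡⟨ cong (_[ x ]≔ (Q ++ R)) (zipWith-replicate _++_ 𝟎 𝟎) ⟨
  zipWith _++_ (emptyEnv n) (emptyEnv n) [ x ]≔ (Q ++ R)   ≡⟨ zipWith-[]≔ _++_ (emptyEnv n) (emptyEnv n) x Q R ⟨
  (emptyEnv n [ x ]≔ Q) ⊎E (emptyEnv n [ x ]≔ R)           ∎))
  where open ≡-Reasoning

-- Inversion and splitting of derivations

record AppInversion {n : ℕ} (Γ : Env n) (a b : Tm n) (X : Pos) (k : ℕ) : Set where
  constructor app-inversion
  field
    {Γa Γb} : Env n
    {P X′}  : Pos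
    πa      : Γa ⊢ a ∶ ((P ⊸ X′) ∷ [])
    πb      : Γb ⊢ b ∶ P
    X′≈X    : X′ ≈P X
    Γ≈      : (Γa ⊎E Γb) ≈E Γ
    size≡   : k ≡ suc (size πa + size πb)

⊢app⁻ : {Γ : Env n} {a b : Tm n} {X : Pos} (π : Γ ⊢ app a b ∶ X) → AppInversion Γ a b X (size π)
⊢app⁻ (at πa πb)     = app-inversion πa πb Pos.refl Env.refl refl
⊢app⁻ (conv π Γ≈ X≈) with ⊢app⁻ π
... | app-inversion πa πb X′≈ Γ′≈ size≡ = app-inversion πa πb (Pos.trans X′≈ X≈) (Env.trans Γ′≈ Γ≈) size≡

record LamInversion {n : ℕ} (Γ : Env n) (s : Tm (suc n)) (N : Neg) (k : ℕ) : Set where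
  constructor lam-inversion
  field
    {Γ₀}  : Env n
    {P Q} : Pos
    body  : (P ∷ Γ₀) ⊢ s ∶ Q
    P⊸Q≈N : (P ⊸ Q) ≈N N
    Γ₀≈Γ  : Γ₀ ≈E Γ
    size≡ : k ≡ size body

⊢lam⁻ : {Γ : Env n} {s : Tm (suc n)} {X : Pos} {N : Neg} (π : Γ ⊢ lam s ∶ X) → X ≈P (N ∷ []) →
        LamInversion Γ s N (size π)
⊢lam⁻ (abs none)           X≈ with ≈P-length X≈
... | ()
⊢lam⁻ (abs (more body ps)) X≈ with ≈P-singleton⁻ X≈
⊢lam⁻ (abs (more body none)) X≈ | P⊸Q≈N , refl =
  lam-inversion body P⊸Q≈N (Env.sym (Env.identityʳ _)) (+-identityʳ (size body))
⊢lam⁻ (conv π Γ≈ X≈) X≈′ with ⊢lam⁻ π (Pos.trans X≈ X≈′)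
... | lam-inversion body P⊸Q≈N Γ₀≈ size≡ = lam-inversion body P⊸Q≈N (Env.trans Γ₀≈ Γ≈) size≡

value-of-𝟎 : {Δ : Env n} {v : Tm n} {P : Pos} → Value v → (π : Δ ⊢ v ∶ P) → P ≈P 𝟎 →
             size π ≡ 0 × Δ ≈E emptyEnv n
value-of-𝟎 _ (ax x P) P≈𝟎 with ≈P-𝟎⁻ P≈𝟎
... | refl = refl , Env.reflexive (replicate-[]≔ x 𝟎)
value-of-𝟎 _ (abs none)       _   = refl , Env.refl
value-of-𝟎 _ (abs (more _ _)) P≈𝟎 with ≈P-𝟎⁻ P≈𝟎
... | ()
value-of-𝟎 v (conv π Δ≈ P≈) P′≈𝟎 with value-of-𝟎 v π (Pos.trans P≈ P′≈𝟎)
... | size≡0 , Δ′≈𝟎 = size≡0 , Env.trans (Env.sym Δ≈) Δ′≈𝟎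
value-of-𝟎 () (at _ _) _

record PremisesSplit {n : ℕ} (Γ : Env n) (t : Tm (suc n)) (Q₁ Q₂ : Pos) (k : ℕ) : Set where
  constructor premises-split
  field
    {Γ₁ Γ₂} : Env n
    {R₁ R₂} : Pos
    ps₁     : Premises Γ₁ t R₁
    ps₂     : Premises Γ₂ t R₂
    R₁≈Q₁   : R₁ ≈P Q₁
    R₂≈Q₂   : R₂ ≈P Q₂
    Γ≈      : Γ ≈E (Γ₁ ⊎E Γ₂)
    size≡   : k ≡ sizes ps₁ + sizes ps₂

split-premises : {Γ : Env n} {t : Tm (suc n)} {P : Pos} (ps : Premises Γ t P) (Q₁ Q₂ : Pos) →
                 P ≈P (Q₁ ++ Q₂) → PremisesSplit Γ t Q₁ Q₂ (sizes ps)
split-premises none Q₁ Q₂ 𝟎≈ with ≈P-𝟎⁻ (Pos.sym 𝟎≈)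
... | Q≡𝟎 = premises-split none none (≈P-reflexive (sym (++-conicalˡ Q₁ Q₂ Q≡𝟎)))
              (≈P-reflexive (sym (++-conicalʳ Q₁ Q₂ Q≡𝟎))) (Env.sym (Env.identityˡ _)) refl
split-premises (more {Γ = Γπ} π ps) Q₁ Q₂ P≈ with ≈P-extract [] _ P≈
... | extraction {xs} {ys} {N′} Q≡ N≈ R≈ with ++-∷-split xs N′ ys Q₁ Q₂ (sym Q≡)
...   | inj₁ (zs , refl , refl)
        with split-premises ps (xs ++ zs) Q₂ (≡-subst (_ ≈P_) (sym (++-assoc xs zs Q₂)) R≈)
...     | premises-split {Γ₁} {Γ₂} ps₁ ps₂ R₁≈ R₂≈ Γ≈ size≡ =
  premises-split (more π ps₁) ps₂ (∷≈ N≈ R₁≈) R₂≈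
    (Env.trans (Env.∙-congˡ Γ≈) (Env.sym (Env.assoc Γπ Γ₁ Γ₂)))
    (trans (cong (size π +_) size≡) (sym (+-assoc (size π) (sizes ps₁) (sizes ps₂))))
split-premises (more {Γ = Γπ} π ps) Q₁ Q₂ P≈
    | extraction {xs} {ys} {N′} Q≡ N≈ R≈ | inj₂ (ws , refl , refl)
        with split-premises ps Q₁ (ws ++ ys) (≡-subst (_ ≈P_) (++-assoc Q₁ ws ys) R≈)
...     | premises-split {Γ₁} {Γ₂} ps₁ ps₂ R₁≈ R₂≈ Γ≈ size≡ =
  premises-split ps₁ (more π ps₂) R₁≈ (∷≈ N≈ R₂≈)
    (Env.trans (Env.∙-congˡ Γ≈) (Env.x∙yz≈y∙xz Γπ Γ₁ Γ₂))
    (trans (cong (size π +_) size≡) (ℕ+.x∙yz≈y∙xz (size π) (sizes ps₁) (sizes ps₂)))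

record Split {n : ℕ} (Δ : Env n) (t : Tm n) (Q₁ Q₂ : Pos) (k : ℕ) : Set where
  constructor split
  field
    {Δ₁ Δ₂} : Env n
    π₁      : Δ₁ ⊢ t ∶ Q₁
    π₂      : Δ₂ ⊢ t ∶ Q₂
    Δ≈      : Δ ≈E (Δ₁ ⊎E Δ₂)
    size≡   : k ≡ size π₁ + size π₂

split-value : {Δ : Env n} {v : Tm n} {P : Pos} → Value v → (π : Δ ⊢ v ∶ P) (Q₁ Q₂ : Pos) →
              P ≈P (Q₁ ++ Q₂) → Split Δ v Q₁ Q₂ (size π)
split-value _  (ax x P)       Q₁ Q₂ P≈ = split (ax x Q₁) (ax x Q₂) (singleton-env-split x P≈) refl
split-value _  (abs ps)       Q₁ Q₂ P≈ with split-premises ps Q₁ Q₂ P≈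
... | premises-split ps₁ ps₂ R₁≈ R₂≈ Γ≈ size≡ =
  split (conv (abs ps₁) Env.refl R₁≈) (conv (abs ps₂) Env.refl R₂≈) Γ≈ size≡
split-value v  (conv π Δ≈ P≈) Q₁ Q₂ P′≈ with split-value v π Q₁ Q₂ (Pos.trans P≈ P′≈)
... | split π₁ π₂ Δ′≈ size≡ = split π₁ π₂ (Env.trans (Env.sym Δ≈) Δ′≈) size≡
split-value () (at _ _)       _  _  _

-- Weakening and substitution

ext-punchIn : {i : Fin (suc n)} {ρ : Fin n → Fin (suc n)} → (∀ j → ρ j ≡ punchIn i j) →
              ∀ j → ext ρ j ≡ punchIn (suc i) j
ext-punchIn ρ≗ zero    = refl
ext-punchIn ρ≗ (suc j) = cong suc (ρ≗ j)

mutual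
  weaken : {i : Fin (suc n)} {ρ : Fin n → Fin (suc n)} → (∀ j → ρ j ≡ punchIn i j) →
           {Γ : Env n} {t : Tm n} {Q : Pos} (π : Γ ⊢ t ∶ Q) →
           Σ (insertAt Γ i 𝟎 ⊢ rename ρ t ∶ Q) λ π′ → size π′ ≡ size π
  weaken {n} {i} ρ≗ (ax x P)
    rewrite ρ≗ x | insertAt-[]≔ (emptyEnv n) i x 𝟎 P | insertAt-replicate i 𝟎 = ax (punchIn i x) P , refl
  weaken {i = i} ρ≗ (at {Γ = Γ₁} {Γ₂} π₁ π₂) with weaken ρ≗ π₁ | weaken ρ≗ π₂
  ... | π₁′ , s₁ | π₂′ , s₂ rewrite zipWith-insertAt _++_ Γ₁ Γ₂ i 𝟎 𝟎 =
    at π₁′ π₂′ , cong₂ (λ a b → suc (a + b)) s₁ s₂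
  weaken ρ≗ (abs ps) with weaken-premises ρ≗ ps
  ... | ps′ , s = abs ps′ , s
  weaken {i = i} ρ≗ (conv π Γ≈ Q≈) with weaken ρ≗ π
  ... | π′ , s = conv π′ (insertAt⁺ i Γ≈ Pos.refl) Q≈ , s

  weaken-premises : {i : Fin (suc n)} {ρ : Fin n → Fin (suc n)} → (∀ j → ρ j ≡ punchIn i j) →
                    {Γ : Env n} {t : Tm (suc n)} {P : Pos} (ps : Premises Γ t P) →
                    Σ (Premises (insertAt Γ i 𝟎) (rename (ext ρ) t) P) λ ps′ → sizes ps′ ≡ sizes ps
  weaken-premises {i = i} ρ≗ none rewrite insertAt-replicate i 𝟎 = none , refl
  weaken-premises {i = i} ρ≗ (more {Γ = Γπ} {Γps} π ps)
    with weaken (ext-punchIn ρ≗) π | weaken-premises ρ≗ ps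
  ... | π′ , s | ps′ , s′ rewrite zipWith-insertAt _++_ Γπ Γps i 𝟎 𝟎 = more π′ ps′ , cong₂ _+_ s s′

weaken₀ : {Γ : Env n} {t : Tm n} {Q : Pos} (π : Γ ⊢ t ∶ Q) → Σ ((𝟎 ∷ Γ) ⊢ wk t ∶ Q) λ π′ → size π′ ≡ size π
weaken₀ = weaken {i = zero} λ _ → refl

Instantiates : (σ : Fin (suc n) → Tm n) (i : Fin (suc n)) (v : Tm n) → Set
Instantiates σ i v = σ i ≡ v × (∀ j → σ (punchIn i j) ≡ var j)

single-instantiates : (v : Tm n) → Instantiates (single v) zero v
single-instantiates v = refl , λ _ → refl

exts-instantiates : {σ : Fin (suc n) → Tm n} {i : Fin (suc n)} {v : Tm n} →
                    Instantiates σ i v → Instantiates (exts σ) (suc i) (wk v)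
exts-instantiates (σi≡v , σ≗) = cong wk σi≡v , λ { zero → refl ; (suc j) → cong wk (σ≗ j) }

wk-value : {v : Tm n} → Value v → Value (wk v)
wk-value (v-var x) = v-var (suc x)
wk-value (v-lam t) = v-lam _

data PunchInView {n : ℕ} (i : Fin (suc n)) : Fin (suc n) → Set where
  at-i    : PunchInView i i
  punched : (j : Fin n) → PunchInView i (punchIn i j)

punchIn-view : (i x : Fin (suc n)) → PunchInView i x
punchIn-view i x with i ≟ x
... | yes refl = at-i
... | no i≢x   = ≡-subst (PunchInView i) (punchIn-punchOut i≢x) (punched (punchOut i≢x))

removeAt-⊎E-interchange : (Θ₁ Θ₂ : Env (suc n)) (i : Fin (suc n)) {Δ Δ₁ Δ₂ : Env n} → Δ ≈E (Δ₁ ⊎E Δ₂) →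
  ((removeAt Θ₁ i ⊎E Δ₁) ⊎E (removeAt Θ₂ i ⊎E Δ₂)) ≈E (removeAt (Θ₁ ⊎E Θ₂) i ⊎E Δ)
removeAt-⊎E-interchange Θ₁ Θ₂ i Δ≈ = Env.trans (Env.interchange _ _ _ _)
  (Env.∙-cong (Env.reflexive (sym (zipWith-removeAt _++_ Θ₁ Θ₂ i))) (Env.sym Δ≈))

+-regroup : (a b x y : ℕ) {a′ b′ z : ℕ} → a′ ≡ a + x → b′ ≡ b + y → z ≡ x + y → a′ + b′ ≡ (a + b) + z
+-regroup a b x y refl refl refl = ℕ+.interchange a x b y

mutual
  substitute : {i : Fin (suc n)} {v : Tm n} {σ : Fin (suc n) → Tm n} → Instantiates σ i v → Value v →
               {Θ : Env (suc n)} {t : Tm (suc n)} {Q : Pos} (π : Θ ⊢ t ∶ Q) →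
               {Δ : Env n} (πv : Δ ⊢ v ∶ lookup Θ i) →
               Σ ((removeAt Θ i ⊎E Δ) ⊢ subst σ t ∶ Q) λ π′ → size π′ ≡ size π + size πv
  substitute {n} {i} σ-inst val (ax x R) {Δ} πv with punchIn-view i x
  ... | at-i rewrite proj₁ σ-inst | removeAt-[]≔ (emptyEnv (suc n)) i R | removeAt-replicate i 𝟎 =
    conv πv (Env.sym (Env.identityˡ Δ)) (≈P-reflexive (lookup∘update i (emptyEnv (suc n)) R)) , refl
  -- The substituted variable does not occur here, so v is typed with 𝟎 and contributes nothing.
  ... | punched j rewrite proj₂ σ-inst j | removeAt-[]≔-punchIn (emptyEnv (suc n)) i j R | removeAt-replicate i 𝟎
    with value-of-𝟎 val πv (≈P-reflexive (trans (lookup∘update′ (punchInᵢ≢i i j ∘ sym) (emptyEnv (suc n)) R)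
                                                (lookup-replicate i 𝟎)))
  ...   | size≡0 , Δ≈𝟎 =
    conv (ax j R) (Env.trans (Env.sym (Env.identityʳ _)) (Env.∙-congˡ (Env.sym Δ≈𝟎))) Pos.refl , sym size≡0
  substitute {i = i} σ-inst val (at {Γ = Θ₁} {Θ₂} π₁ π₂) πv
    with split-value val πv (lookup Θ₁ i) (lookup Θ₂ i) (≈P-reflexive (lookup-zipWith _++_ i Θ₁ Θ₂))
  ... | split πv₁ πv₂ Δ≈ size≡ with substitute σ-inst val π₁ πv₁ | substitute σ-inst val π₂ πv₂
  ...   | π₁′ , s₁ | π₂′ , s₂ =
    conv (at π₁′ π₂′) (removeAt-⊎E-interchange Θ₁ Θ₂ i Δ≈) Pos.refl ,
    cong suc (+-regroup (size π₁) (size π₂) (size πv₁) (size πv₂) s₁ s₂ size≡)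
  substitute σ-inst val (abs ps) πv with substitute-premises σ-inst val ps πv
  ... | _ , ps′ , Θ′≈ , s = conv (abs ps′) Θ′≈ Pos.refl , s
  substitute {i = i} σ-inst val (conv π Θ≈ Q≈) πv
    with substitute σ-inst val π (conv πv Env.refl (Pos.sym (Pointwise.lookup Θ≈ i)))
  ... | π′ , s = conv π′ (Env.∙-congʳ (removeAt⁺ i Θ≈)) Q≈ , s

  substitute-premises : {i : Fin (suc n)} {v : Tm n} {σ : Fin (suc n) → Tm n} → Instantiates σ i v → Value v →
    {Θ : Env (suc n)} {t : Tm (suc (suc n))} {P : Pos} (ps : Premises Θ t P) →
    {Δ : Env n} (πv : Δ ⊢ v ∶ lookup Θ i) →
    Σ (Env n) λ Θ′ → Σ (Premises Θ′ (subst (exts σ) t) P) λ ps′ →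
      Θ′ ≈E (removeAt Θ i ⊎E Δ) × sizes ps′ ≡ sizes ps + size πv
  substitute-premises {i = i} σ-inst val none πv with value-of-𝟎 val πv (≈P-reflexive (lookup-replicate i 𝟎))
  ... | size≡0 , Δ≈𝟎 =
    _ , none , Env.sym (Env.trans (Env.∙-cong (Env.reflexive (removeAt-replicate i 𝟎)) Δ≈𝟎) (Env.identityˡ _)) ,
    sym size≡0
  substitute-premises {i = i} σ-inst val (more {Γ = Γπ} {Γps} {P = R} π ps) πv
    with split-value val πv (lookup Γπ i) (lookup Γps i) (≈P-reflexive (lookup-zipWith _++_ i Γπ Γps))
  ... | split {Δ₁} πv₁ πv₂ Δ≈ size≡ with weaken₀ πv₁
  ...   | πv₁′ , s₀ with substitute {i = suc i} (exts-instantiates σ-inst) (wk-value val) π πv₁′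
                       | substitute-premises σ-inst val ps πv₂
  ...     | π′ , s₁ | _ , ps′ , Θ′≈ , s₂ =
    _ , more (conv π′ body-env Pos.refl) ps′ ,
    Env.trans (Env.∙-congˡ Θ′≈) (removeAt-⊎E-interchange Γπ Γps i Δ≈) ,
    +-regroup (size π) (sizes ps) (size πv₁) (size πv₂) (trans s₁ (cong (size π +_) s₀)) s₂ size≡
    where
    body-env : (removeAt (R ∷ Γπ) (suc i) ⊎E (𝟎 ∷ Δ₁)) ≈E (R ∷ (removeAt Γπ i ⊎E Δ₁))
    body-env = Env.trans (Env.reflexive (cong (_⊎E (𝟎 ∷ Δ₁)) (removeAt-suc R Γπ i)))
                         (≈P-reflexive (++-identityʳ R) ∷ Env.refl)

-- Quantitative subject reduction

abs₁ : {Γ : Env n} {t : Tm (suc n)} {P Q : Pos} (π : (P ∷ Γ) ⊢ t ∶ Q) →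
       Σ (Γ ⊢ lam t ∶ ((P ⊸ Q) ∷ [])) λ π′ → size π′ ≡ size π
abs₁ π = conv (abs (more π none)) (Env.identityʳ _) Pos.refl , +-identityʳ (size π)

βv-root : {Γ : Env n} {t t′ : Tm n} {X : Pos} → t ↦βv t′ → (π : Γ ⊢ t ∶ X) →
          Σ (Γ ⊢ t′ ∶ X) λ π′ → size π ≡ suc (size π′)
βv-root (βv t v val) π with ⊢app⁻ π
... | app-inversion πλ πv X′≈X Γ≈ size≡ with ⊢lam⁻ πλ Pos.refl
...   | lam-inversion body (⊸≈ P≈ Q≈) Γ₀≈ size≡λ
        with substitute (single-instantiates v) val body (conv πv Env.refl (Pos.sym P≈))
...     | π′ , s =
  conv π′ (Env.trans (Env.∙-congʳ Γ₀≈) Γ≈) (Pos.trans Q≈ X′≈X) ,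
  trans size≡ (cong suc (trans (cong (_+ size πv) size≡λ) (sym s)))

σ-root : {Γ : Env n} {t t′ : Tm n} {X : Pos} → t ↦σ t′ → (π : Γ ⊢ t ∶ X) →
         Σ (Γ ⊢ t′ ∶ X) λ π′ → size π ≡ size π′
σ-root {Γ = Γ} (σ₁ t u s) π with ⊢app⁻ π
... | app-inversion {Γb = Γs} πl πs X′≈X Γ≈ size≡ with ⊢app⁻ πl
...   | app-inversion {Γb = Γu} πλ πu Y≈ Γl≈ size≡l with ⊢lam⁻ πλ Pos.refl
...     | lam-inversion {Γ₀} {P₀} body (⊸≈ P≈ Q≈) Γ₀≈ size≡λ with weaken₀ πs
...       | πs′ , size≡s with abs₁ (conv (at (conv body Env.refl (Pos.trans Q≈ Y≈)) πs′)
                                         (≈P-reflexive (++-identityʳ P₀) ∷ Env.refl) Pos.refl)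
...         | πλ′ , size≡λ′ =
  conv (at πλ′ (conv πu Env.refl (Pos.sym P≈))) env X′≈X , size-preserved
  where
  env : ((Γ₀ ⊎E Γs) ⊎E Γu) ≈E Γ
  env = Env.trans (Env.xy∙z≈xz∙y _ _ _)
          (Env.trans (Env.∙-congʳ (Env.trans (Env.∙-congʳ Γ₀≈) Γl≈)) Γ≈)
  open ≡-Reasoning
  size-preserved : size π ≡ suc (size πλ′ + size πu)
  size-preserved = begin
    size π                                      ≡⟨ size≡ ⟩
    suc (size πl + size πs)                     ≡⟨ cong (λ k → suc (k + size πs)) size≡l ⟩
    suc (suc (size πλ + size πu) + size πs)     ≡⟨ cong (λ k → suc (suc (k + size πu) + size πs)) size≡λ ⟩
    suc (suc (size body + size πu) + size πs)   ≡⟨ cong (λ k → suc (suc k)) (ℕ+.xy∙z≈xz∙y (size body) (size πu) (size πs)) ⟩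
    suc (suc (size body + size πs) + size πu)   ≡⟨ cong (λ k → suc (suc (size body + k) + size πu)) size≡s ⟨
    suc (suc (size body + size πs′) + size πu)  ≡⟨ cong (λ k → suc (k + size πu)) size≡λ′ ⟨
    suc (size πλ′ + size πu)                    ∎
σ-root {Γ = Γ} (σ₃ v s u val) π with ⊢app⁻ π
... | app-inversion {Γv} πv πr X′≈X Γ≈ size≡ with ⊢app⁻ πr
...   | app-inversion {Γb = Γu} πλ πu Y≈ Γr≈ size≡r with ⊢lam⁻ πλ Pos.refl
...     | lam-inversion {Γ₀} body (⊸≈ P≈ Q≈) Γ₀≈ size≡λ with weaken₀ πv
...       | πv′ , size≡v with abs₁ (at πv′ (conv body Env.refl (Pos.trans Q≈ Y≈)))
...         | πλ′ , size≡λ′ =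
  conv (at πλ′ (conv πu Env.refl (Pos.sym P≈))) env X′≈X , size-preserved
  where
  env : ((Γv ⊎E Γ₀) ⊎E Γu) ≈E Γ
  env = Env.trans (Env.assoc _ _ _)
          (Env.trans (Env.∙-congˡ (Env.trans (Env.∙-congʳ Γ₀≈) Γr≈)) Γ≈)
  open ≡-Reasoning
  size-preserved : size π ≡ suc (size πλ′ + size πu)
  size-preserved = begin
    size π                                      ≡⟨ size≡ ⟩
    suc (size πv + size πr)                     ≡⟨ cong (λ k → suc (size πv + k)) size≡r ⟩
    suc (size πv + suc (size πλ + size πu))     ≡⟨ cong (λ k → suc (size πv + suc (k + size πu))) size≡λ ⟩
    suc (size πv + suc (size body + size πu))   ≡⟨ cong suc (+-suc (size πv) _) ⟩
    suc (suc (size πv + (size body + size πu))) ≡⟨ cong (λ k → suc (suc k)) (+-assoc (size πv) _ _) ⟨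
    suc (suc (size πv + size body) + size πu)   ≡⟨ cong (λ k → suc (suc (k + size body) + size πu)) size≡v ⟨
    suc (suc (size πv′ + size body) + size πu)  ≡⟨ cong (λ k → suc (k + size πu)) size≡λ′ ⟨
    suc (size πλ′ + size πu)                    ∎

module BalancedClosure (R : Rel) (c : ℕ)
  (root-step : ∀ {n} {Γ : Env n} {t t′ : Tm n} {X : Pos} → R t t′ → (π : Γ ⊢ t ∶ X) →
               Σ (Γ ⊢ t′ ∶ X) λ π′ → size π ≡ c + size π′)
  where

  shiftˡ : {a a′ : ℕ} (b : ℕ) → a ≡ c + a′ → suc (a + b) ≡ c + suc (a′ + b)
  shiftˡ {a′ = a′} b refl = trans (cong suc (+-assoc c a′ b)) (sym (+-suc c (a′ + b)))

  shiftʳ : (a : ℕ) {b b′ : ℕ} → b ≡ c + b′ → suc (a + b) ≡ c + suc (a + b′)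
  shiftʳ a {b′ = b′} refl = trans (cong suc (ℕ+.x∙yz≈y∙xz a c b′)) (sym (+-suc c (a + b′)))

  mutual
    step : {Γ : Env n} {t t′ : Tm n} {X : Pos} → Bal R t t′ → (π : Γ ⊢ t ∶ X) →
           Σ (Γ ⊢ t′ ∶ X) λ π′ → size π ≡ c + size π′
    step (root r) π = root-step r π
    step (redexλ r) π with ⊢app⁻ π
    ... | app-inversion πλ πu X′≈X Γ≈ size≡ with step-under-λ r πλ
    ...   | πλ′ , s = conv (at πλ′ πu) Γ≈ X′≈X ,
                      trans size≡ (shiftˡ (size πu) (trans s (cong (_+ size πλ′) (*-identityʳ c))))
    step (appL r) π with ⊢app⁻ π
    ... | app-inversion πa πb X′≈X Γ≈ size≡ with step r πa
    ...   | πa′ , s = conv (at πa′ πb) Γ≈ X′≈X , trans size≡ (shiftˡ (size πb) s)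
    step (appR r) π with ⊢app⁻ π
    ... | app-inversion πa πb X′≈X Γ≈ size≡ with step r πb
    ...   | πb′ , s = conv (at πa πb′) Γ≈ X′≈X , trans size≡ (shiftʳ (size πa) s)

    -- A step under λ is performed once in each of the length X premises of rule (λ).
    step-under-λ : {Γ : Env n} {s s′ : Tm (suc n)} {X : Pos} → Bal R s s′ → (π : Γ ⊢ lam s ∶ X) →
                   Σ (Γ ⊢ lam s′ ∶ X) λ π′ → size π ≡ c * length X + size π′
    step-under-λ r (abs ps) with step-premises r ps
    ... | ps′ , s = abs ps′ , s
    step-under-λ r (conv π Γ≈ X≈) with step-under-λ r π
    ... | π′ , s = conv π′ Γ≈ X≈ , trans s (cong (λ k → c * k + size π′) (≈P-length X≈))

    step-premises : {Γ : Env n} {s s′ : Tm (suc n)} {X : Pos} → Bal R s s′ → (ps : Premises Γ s X) →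
                    Σ (Premises Γ s′ X) λ ps′ → sizes ps ≡ c * length X + sizes ps′
    step-premises r none = none , sym (trans (+-identityʳ (c * 0)) (*-zeroʳ c))
    step-premises r (more {R = X} π ps) with step r π | step-premises r ps
    ... | π′ , s | ps′ , s′ =
      more π′ ps′ ,
      trans (+-regroup c (c * length X) (size π′) (sizes ps′) s s′ refl)
            (cong (_+ (size π′ + sizes ps′)) (sym (*-suc c (length X))))

βv-step : {Γ : Env n} {t t′ : Tm n} {X : Pos} → t →βv t′ → (π : Γ ⊢ t ∶ X) →
          Σ (Γ ⊢ t′ ∶ X) λ π′ → size π ≡ suc (size π′)
βv-step = BalancedClosure.step _↦βv_ 1 βv-root

σ-step : {Γ : Env n} {t t′ : Tm n} {X : Pos} → t →σ t′ → (π : Γ ⊢ t ∶ X) →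
         Σ (Γ ⊢ t′ ∶ X) λ π′ → size π ≡ size π′
σ-step = BalancedClosure.step _↦σ_ 0 σ-root

-- Reduction sequences

ShSeq-size : {Γ : Env n} {t u : Tm n} {X : Pos} (ρ : ShSeq t u) (π : Γ ⊢ t ∶ X) →
             Σ (Γ ⊢ u ∶ X) λ π′ → size π ≡ #βv ρ + size π′
ShSeq-size done        π = π , refl
ShSeq-size (stepβ r ρ) π with βv-step r π
... | π₁ , s₁ with ShSeq-size ρ π₁
...   | π′ , s = π′ , trans s₁ (cong suc s)
ShSeq-size (stepσ r ρ) π with σ-step r π
... | π₁ , s₁ with ShSeq-size ρ π₁
...   | π′ , s = π′ , trans s₁ s

closed-progress : (t : Tm 0) → (∃ λ t′ → t →βv t′) ⊎ (∃ λ s → t ≡ lam s)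
closed-progress (var ())
closed-progress (lam s)   = inj₂ (s , refl)
closed-progress (app t u) with closed-progress t
... | inj₁ (t′ , r)      = inj₁ (app t′ u , appL r)
... | inj₂ (s , refl) with closed-progress u
...   | inj₁ (u′ , r)      = inj₁ (app t u′ , appR r)
...   | inj₂ (s′ , refl) = inj₁ (s [ lam s′ /0] , root (βv s (lam s′) (v-lam s′)))

lam-ShNormal : (s : Tm (suc n)) → ShNormal (lam s)
lam-ShNormal s _ (shβ (root ()))
lam-ShNormal s _ (shσ (root ()))

closed-ShNormal⇒lam : (u : Tm 0) → ShNormal u → ∃ λ s → u ≡ lam s
closed-ShNormal⇒lam u u-normal with closed-progress u
... | inj₁ (u′ , r)  = ⊥-elim (u-normal u′ (shβ r))
... | inj₂ lam-form = lam-form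

#βv-to-normal : {t u : Tm 0} (π : emptyEnv 0 ⊢ t ∶ 𝟎) (ρ : ShSeq t u) → ShNormal u → #βv ρ ≡ size π
#βv-to-normal {u = u} π ρ u-normal with ShSeq-size ρ π | closed-ShNormal⇒lam u u-normal
... | π′ , s | s′ , refl = begin
  #βv ρ              ≡⟨ +-identityʳ (#βv ρ) ⟨
  #βv ρ + 0          ≡⟨ cong (#βv ρ +_) (proj₁ (value-of-𝟎 (v-lam s′) π′ Pos.refl)) ⟨
  #βv ρ + size π′    ≡⟨ s ⟨
  size π             ∎
  where open ≡-Reasoning

typed-closed-normalizes : {t : Tm 0} {X : Pos} (k : ℕ) (π : emptyEnv 0 ⊢ t ∶ X) → size π ≡ k →
                          ∃₂ λ u (ρ : ShSeq t u) → ShNormal u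
typed-closed-normalizes {t} k π size≡ with closed-progress t
... | inj₂ (s , refl) = lam s , done , lam-ShNormal s
... | inj₁ (t′ , r) with βv-step r π
typed-closed-normalizes zero    π size≡ | inj₁ _ | _ , s with () ← trans (sym size≡) s
typed-closed-normalizes (suc k) π size≡ | inj₁ (t′ , r) | π′ , s
  with typed-closed-normalizes k π′ (suc-injective (trans (sym s) size≡))
... | u , ρ , u-normal = u , stepβ r ρ , u-normal

theorem6p3 : (t : Tm 0) → βvNormalizable t → (π : emptyEnv 0 ⊢ t ∶ 𝟎) →
    (Σ (Tm 0) λ u → Σ (ShSeq t u) λ ρ → ShNormal u × (#βv ρ ≡ size π))
    × ((u : Tm 0) (ρ : ShSeq t u) → ShNormal u → #βv ρ ≡ size π)
theorem6p3 t _ π with typed-closed-normalizes (size π) π refl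
... | u , ρ , u-normal = (u , ρ , u-normal , #βv-to-normal π ρ u-normal) , λ _ → #βv-to-normal π
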